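{- For every even integer $n>1$, $TAUT_{NM_{n+1}}\forall\subsetneq TAUT_{NM_n}\forall$.
   Context: $NM_k$ ($k\ge2$) is the $k$-element NM-chain, realized on $\{0,\frac1{k-1},\dots,\frac{k-2}{k-1},1\}$ with the real order, $n(x)=1-x$, $x*y=0$ if $x\le1-y$ and $\min(x,y)$ otherwise, $x\Rightarrow y=1$ if $x\le y$ and $\max(1-x,y)$ otherwise. First-order formulas over a fixed countable predicate language use $\&,\land,\to,\bot,\forall,\exists$ interpreted by $*,\min,\Rightarrow,0$, infimum, supremum. $TAUT_{\mathcal{A}}\forall$ is the set of formulas taking value $1$ under every evaluation in every $\mathcal{A}$-model (nonempty domain, maps $M^k\to A$ for $k$-ary predicates, elements for constants). $\subsetneq$ is strict inclusion. -}

module Defs where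

open import Data.Nat using (ℕ; zero; suc; _≟_)
open import Data.Fin using (Fin; fromℕ; opposite) renaming (zero to fzero)
open import Data.Fin.Base using (_≤_)
open import Data.Fin.Properties using (_≤?_)
open import Data.Vec using (Vec; []; _∷_; map)
open import Data.Product using (Σ; ∃; _×_; _,_)
open import Data.Unit using (⊤)
open import Level using (Lift)
open import Relation.Binary.PropositionalEquality using (_≡_)
open import Relation.Nullary using (¬_; yes; no)

data Term : Set where
  var   : ℕ → Term
  const : ℕ → Term

data Formula : Set where
  atom  : (k : ℕ) → (i : ℕ) → Vec Term k → Formula
  _&_   : Formula → Formula → Formula
  _∧_   : Formula → Formula → Formula
  _⇒_   : Formula → Formula → Formula
  ⊥f    : Formula
  all   : ℕ → Formula → Formula
  ex    : ℕ → Formula → Formula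

-- The NM-chain with (suc m) elements, realised on Fin (suc m):
-- i : Fin (suc m) stands for the real number i/m.

module NMChain (m : ℕ) where
  C : Set
  C = Fin (suc m)

  top : C
  top = fromℕ m

  bot : C
  bot = fzero

  neg : C → C
  neg = opposite

  min : C → C → C
  min x y with x ≤? y
  ... | yes _ = x
  ... | no  _ = y

  max : C → C → C
  max x y with x ≤? y
  ... | yes _ = y
  ... | no  _ = x

  _⊛_ : C → C → C
  x ⊛ y with x ≤? neg y
  ... | yes _ = bot
  ... | no  _ = min x y

  _⇛_ : C → C → C
  x ⇛ y with x ≤? y
  ... | yes _ = top
  ... | no  _ = max (neg x) y

  IsInf : (C → Set) → C → Set
  IsInf S v = (∀ w → S w → v ≤ w) × (∀ (u : C) → (∀ w → S w → u ≤ w) → u ≤ v)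

  IsSup : (C → Set) → C → Set
  IsSup S v = (∀ w → S w → w ≤ v) × (∀ (u : C) → (∀ w → S w → w ≤ u) → v ≤ u)

  record Model : Set₁ where
    field
      Dom      : Set
      witness  : Dom
      predI    : (k i : ℕ) → Vec Dom k → C
      constI   : ℕ → Dom

  module _ (M : Model) where
    open Model M

    Env : Set
    Env = ℕ → Dom

    update : Env → ℕ → Dom → Env
    update e x d y with x ≟ y
    ... | yes _ = d
    ... | no  _ = e y

    termVal : Env → Term → Dom
    termVal e (var x)   = e x
    termVal e (const c) = constI c

    -- Val φ e v : "the truth value of φ in M under e is v".
    -- (Relational, since infima/suprema over an arbitrary domain are not
    -- computable constructively; classically Val φ e is the graph of the
    -- usual Tarskian valuation.)
    Val : Formula → Env → C → Set
    Val (atom k i ts) e v = predI k i (map (termVal e) ts) ≡ v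
    Val (φ & ψ) e v = Σ C λ a → Σ C λ b → Val φ e a × Val ψ e b × (v ≡ a ⊛ b)
    Val (φ ∧ ψ) e v = Σ C λ a → Σ C λ b → Val φ e a × Val ψ e b × (v ≡ min a b)
    Val (φ ⇒ ψ) e v = Σ C λ a → Σ C λ b → Val φ e a × Val ψ e b × (v ≡ a ⇛ b)
    Val ⊥f e v = v ≡ bot
    Val (all x φ) e v = IsInf (λ w → Σ Dom λ d → Val φ (update e x d) w) v
    Val (ex x φ) e v  = IsSup (λ w → Σ Dom λ d → Val φ (update e x d) w) v

  Taut : Formula → Set₁
  Taut φ = (M : Model) (e : Env M) (v : C) → Val M φ e v → v ≡ top

-- TAUT k φ : φ ∈ TAUT_{NM_k}∀  (NM_k is only meaningful for k ≥ 2;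
-- the k = 0 clause is a dummy and never used below).
TAUT : ℕ → Formula → Set₁
TAUT zero    φ = Lift _ ⊤
TAUT (suc m) φ = NMChain.Taut m φ

_⊊_ : (Formula → Set₁) → (Formula → Set₁) → Set₁
A ⊊ B = (∀ φ → A φ → B φ) × (∃ λ φ → B φ × ¬ A φ)

module Submission where

-- NM_{2j+2} sits inside NM_{2j+3} as the complement of the negation fixpoint
-- (j+1)/(2j+2); the inclusion is `punchIn middle`.  It is an order embedding
-- commuting with the negation, hence with every connective, and it has both
-- Galois adjoints (Ceiling, Floor), hence it preserves and reflects all infima
-- and suprema.  So it carries values of formulas in a model over NM_{2j+2} to
-- values in the same model read in NM_{2j+3}, and every tautology of NM_{2j+3}
-- is one of NM_{2j+2}.  Conversely χ = ∼(p & p) ⇒ (∼p & ∼p) evaluates at p = x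
-- to max(x, n x) unless n x = x, where it evaluates to 0.  Hence ∼χ ⇒ χ is a
-- tautology of any NM-chain without a negation fixpoint, such as NM_{2j+2},
-- but takes the value 0 at the fixpoint of NM_{2j+3}.

open import Defs
open import Data.Nat as ℕ using (ℕ; zero; suc; _+_; _*_; _∸_; z≤n; s≤s)
open import Data.Nat.Divisibility using (_∣_; divides)
import Data.Nat.Properties as ℕ
open import Data.Fin using (Fin; toℕ; fromℕ; fromℕ<; opposite; punchIn; punchOut; _≤_; _<_)
  renaming (zero to fzero; suc to fsuc)
open import Data.Fin.Properties
  using ( toℕ-injective; toℕ-fromℕ; toℕ-fromℕ<; toℕ<n; ≤fromℕ; opposite-prop; opposite-involutive
        ; _≤?_; _≟_; ≤-reflexive; ≤-trans; ≤-antisym; punchIn-mono-≤; punchIn-cancel-≤; punchIn-punchOut )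
open import Data.Product using (Σ; _×_; _,_)
open import Data.Sum using (_⊎_; inj₁; inj₂)
open import Data.Unit using (⊤; tt)
open import Data.Vec using ([])
open import Data.Vec.Properties using (map-cong)
open import Relation.Binary.PropositionalEquality
open import Relation.Nullary using (¬_; Dec; yes; no; contradiction)

module NMChainProperties (m : ℕ) where
  open NMChain m

  neg-top : neg top ≡ bot
  neg-top = toℕ-injective (begin
    toℕ (opposite (fromℕ m)) ≡⟨ opposite-prop (fromℕ m) ⟩
    m ∸ toℕ (fromℕ m)        ≡⟨ cong (m ∸_) (toℕ-fromℕ m) ⟩
    m ∸ m                    ≡⟨ ℕ.n∸n≡0 m ⟩
    0                        ∎)
    where open ≡-Reasoning

  min-idem : ∀ x → min x x ≡ x
  min-idem x with x ≤? x
  ... | yes _ = refl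
  ... | no  _ = refl

  ⊛-≤neg : ∀ {x y} → x ≤ neg y → x ⊛ y ≡ bot
  ⊛-≤neg {x} {y} x≤ny with x ≤? neg y
  ... | yes _   = refl
  ... | no  x≰ny = contradiction x≤ny x≰ny

  ⊛-≰neg : ∀ {x y} → ¬ x ≤ neg y → x ⊛ y ≡ min x y
  ⊛-≰neg {x} {y} x≰ny with x ≤? neg y
  ... | yes x≤ny = contradiction x≤ny x≰ny
  ... | no  _    = refl

  ⇛-≤ : ∀ {x y} → x ≤ y → x ⇛ y ≡ top
  ⇛-≤ {x} {y} x≤y with x ≤? y
  ... | yes _   = refl
  ... | no  x≰y = contradiction x≤y x≰y

  ⇛-bot : ∀ x → x ⇛ bot ≡ neg x
  ⇛-bot x with x ≤? bot
  ... | yes x≤0 = cong neg (sym (toℕ-injective {i = x} {j = bot} (ℕ.n≤0⇒n≡0 x≤0)))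
  ... | no  _ with neg x ≤? bot
  ...   | yes nx≤0 = toℕ-injective (sym (ℕ.n≤0⇒n≡0 nx≤0))
  ...   | no  _    = refl

  top-⇛ : ∀ y → top ⇛ y ≡ y
  top-⇛ y with top ≤? y
  ... | yes top≤y = ≤-antisym top≤y (≤fromℕ y)
  ... | no  _ with neg top ≤? y
  ...   | yes _      = refl
  ...   | no  ntop≰y = contradiction (subst (_≤ y) (sym neg-top) z≤n) ntop≰y

  ⊛-self-neg< : ∀ {x} → neg x < x → x ⊛ x ≡ x
  ⊛-self-neg< {x} nx<x = trans (⊛-≰neg (ℕ.<⇒≱ nx<x)) (min-idem x)

record Ceiling {k k'} (f : Fin k → Fin k') (u : Fin k') : Set where
  constructor mkCeiling
  field
    point  : Fin k
    bounds : u ≤ f point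
    least  : ∀ y → u ≤ f y → point ≤ y

record Floor {k k'} (f : Fin k → Fin k') (u : Fin k') : Set where
  constructor mkFloor
  field
    point    : Fin k
    bounds   : f point ≤ u
    greatest : ∀ y → f y ≤ u → y ≤ point

image-ceiling : ∀ {k k'} {f : Fin k → Fin k'} → (∀ {x y} → f x ≤ f y → x ≤ y) → ∀ x → Ceiling f (f x)
image-ceiling cancel x = mkCeiling x ℕ.≤-refl λ _ → cancel

image-floor : ∀ {k k'} {f : Fin k → Fin k'} → (∀ {x y} → f x ≤ f y → x ≤ y) → ∀ x → Floor f (f x)
image-floor cancel x = mkFloor x ℕ.≤-refl λ _ → cancel

record IsCompleteEmbedding {m m'} (f : Fin (suc m) → Fin (suc m')) : Set where
  field
    mono-≤   : ∀ {x y} → x ≤ y → f x ≤ f y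
    cancel-≤ : ∀ {x y} → f x ≤ f y → x ≤ y
    neg-homo : ∀ x → f (NMChain.neg m x) ≡ NMChain.neg m' (f x)
    bot-homo : f fzero ≡ fzero
    ceiling  : ∀ u → Ceiling f u
    floor    : ∀ u → Floor f u

module CompleteEmbedding {m m'} {f : Fin (suc m) → Fin (suc m')} (isEmb : IsCompleteEmbedding f) where
  open IsCompleteEmbedding isEmb
  private
    module S = NMChain m
    module T = NMChain m'

  top-homo : f S.top ≡ T.top
  top-homo = trans (neg-homo S.bot) (cong T.neg bot-homo)

  injective : ∀ {x y} → f x ≡ f y → x ≡ y
  injective fx≡fy = ≤-antisym (cancel-≤ (≤-reflexive fx≡fy)) (cancel-≤ (≤-reflexive (sym fx≡fy)))

  min-homo : ∀ x y → f (S.min x y) ≡ T.min (f x) (f y)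
  min-homo x y with x ≤? y | f x ≤? f y
  ... | yes _   | yes _     = refl
  ... | yes x≤y | no fx≰fy  = contradiction (mono-≤ x≤y) fx≰fy
  ... | no  x≰y | yes fx≤fy = contradiction (cancel-≤ fx≤fy) x≰y
  ... | no  _   | no  _     = refl

  max-homo : ∀ x y → f (S.max x y) ≡ T.max (f x) (f y)
  max-homo x y with x ≤? y | f x ≤? f y
  ... | yes _   | yes _     = refl
  ... | yes x≤y | no fx≰fy  = contradiction (mono-≤ x≤y) fx≰fy
  ... | no  x≰y | yes fx≤fy = contradiction (cancel-≤ fx≤fy) x≰y
  ... | no  _   | no  _     = refl

  ⊛-homo : ∀ x y → f (x S.⊛ y) ≡ f x T.⊛ f y
  ⊛-homo x y with x ≤? S.neg y | f x ≤? T.neg (f y)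
  ... | yes _    | yes _      = bot-homo
  ... | yes x≤ny | no fx≰nfy  = contradiction (subst (f x ≤_) (neg-homo y) (mono-≤ x≤ny)) fx≰nfy
  ... | no  x≰ny | yes fx≤nfy = contradiction (cancel-≤ (subst (f x ≤_) (sym (neg-homo y)) fx≤nfy)) x≰ny
  ... | no  _    | no  _      = min-homo x y

  ⇛-homo : ∀ x y → f (x S.⇛ y) ≡ f x T.⇛ f y
  ⇛-homo x y with x ≤? y | f x ≤? f y
  ... | yes _   | yes _     = top-homo
  ... | yes x≤y | no fx≰fy  = contradiction (mono-≤ x≤y) fx≰fy
  ... | no  x≰y | yes fx≤fy = contradiction (cancel-≤ fx≤fy) x≰y
  ... | no  _   | no  _     = trans (max-homo (S.neg x) y) (cong (λ z → T.max z (f y)) (neg-homo x))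

  record IsImage (X : S.C → Set) (Y : T.C → Set) : Set where
    field
      image⊆ : ∀ {x} → X x → Y (f x)
      ⊆image : ∀ {w} → Y w → Σ S.C λ x → X x × w ≡ f x

  module _ {X : S.C → Set} {Y : T.C → Set} (Y=fX : IsImage X Y) where
    open IsImage Y=fX

    lowerBound-homo : ∀ {u} → (∀ x → X x → u ≤ x) → ∀ w → Y w → f u ≤ w
    lowerBound-homo u≤X w Yw with ⊆image Yw
    ... | x , Xx , refl = mono-≤ (u≤X x Xx)

    upperBound-homo : ∀ {u} → (∀ x → X x → x ≤ u) → ∀ w → Y w → w ≤ f u
    upperBound-homo X≤u w Yw with ⊆image Yw
    ... | x , Xx , refl = mono-≤ (X≤u x Xx)

    ceiling-lowerBound : ∀ {w} → (∀ y → Y y → w ≤ y) → ∀ x → X x → Ceiling.point (ceiling w) ≤ x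
    ceiling-lowerBound {w} w≤Y x Xx = Ceiling.least (ceiling w) x (w≤Y (f x) (image⊆ Xx))

    floor-upperBound : ∀ {w} → (∀ y → Y y → y ≤ w) → ∀ x → X x → x ≤ Floor.point (floor w)
    floor-upperBound {w} Y≤w x Xx = Floor.greatest (floor w) x (Y≤w (f x) (image⊆ Xx))

    IsInf-homo : ∀ {v} → S.IsInf X v → T.IsInf Y (f v)
    IsInf-homo {v} (v≤X , v-greatest) = lowerBound-homo v≤X , λ u u≤Y →
      ≤-trans (Ceiling.bounds (ceiling u)) (mono-≤ (v-greatest _ (ceiling-lowerBound u≤Y)))

    IsSup-homo : ∀ {v} → S.IsSup X v → T.IsSup Y (f v)
    IsSup-homo {v} (X≤v , v-least) = upperBound-homo X≤v , λ u Y≤u →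
      ≤-trans (mono-≤ (v-least _ (floor-upperBound Y≤u))) (Floor.bounds (floor u))

    IsInf-reflect : ∀ {w} → T.IsInf Y w → Σ S.C λ v → S.IsInf X v × w ≡ f v
    IsInf-reflect {w} (w≤Y , w-greatest) = c , (c≤X , c-greatest) , w≡fc
      where
      open Ceiling (ceiling w) renaming (point to c)
      c≤X = ceiling-lowerBound w≤Y
      w≡fc : w ≡ f c
      w≡fc = ≤-antisym bounds (w-greatest (f c) (lowerBound-homo c≤X))
      c-greatest : ∀ u → (∀ x → X x → u ≤ x) → u ≤ c
      c-greatest u u≤X = cancel-≤ (subst (f u ≤_) w≡fc (w-greatest (f u) (lowerBound-homo u≤X)))

    IsSup-reflect : ∀ {w} → T.IsSup Y w → Σ S.C λ v → S.IsSup X v × w ≡ f v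
    IsSup-reflect {w} (Y≤w , w-least) = c , (X≤c , c-least) , w≡fc
      where
      open Floor (floor w) renaming (point to c)
      X≤c = floor-upperBound Y≤w
      w≡fc : w ≡ f c
      w≡fc = ≤-antisym (w-least (f c) (upperBound-homo X≤c)) bounds
      c-least : ∀ u → (∀ x → X x → x ≤ u) → c ≤ u
      c-least u X≤u = cancel-≤ (subst (_≤ f u) w≡fc (w-least (f u) (upperBound-homo X≤u)))

  module _ (M : S.Model) where
    open S.Model M

    imageModel : T.Model
    imageModel = record { Dom = Dom ; witness = witness ; predI = λ k i ds → f (predI k i ds) ; constI = constI }

    -- S.update and T.update are distinct definitions, so the environments of
    -- the two models can only be related pointwise.
    update-≗ : ∀ {ρ ρ'} → ρ ≗ ρ' → ∀ x d → S.update M ρ x d ≗ T.update imageModel ρ' x d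
    update-≗ ρ≗ρ' x d y with x ℕ.≟ y
    ... | yes _ = refl
    ... | no  _ = ρ≗ρ' y

    termVal-≗ : ∀ {ρ ρ'} → ρ ≗ ρ' → ∀ t → S.termVal M ρ t ≡ T.termVal imageModel ρ' t
    termVal-≗ ρ≗ρ' (var x)   = ρ≗ρ' x
    termVal-≗ ρ≗ρ' (const c) = refl

    Val-homo : ∀ φ {ρ ρ' v} → ρ ≗ ρ' → S.Val M φ ρ v → T.Val imageModel φ ρ' (f v)
    Val-reflect : ∀ φ {ρ ρ' w} → ρ ≗ ρ' → T.Val imageModel φ ρ' w → Σ S.C λ v → S.Val M φ ρ v × w ≡ f v
    instances-isImage : ∀ φ {ρ ρ'} → ρ ≗ ρ' → ∀ x →
      IsImage (λ v → Σ Dom λ d → S.Val M φ (S.update M ρ x d) v)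
              (λ w → Σ Dom λ d → T.Val imageModel φ (T.update imageModel ρ' x d) w)

    Val-homo (atom k i ts) ρ≗ρ' refl = cong (λ ds → f (predI k i ds)) (sym (map-cong (termVal-≗ ρ≗ρ') ts))
    Val-homo (φ & ψ) ρ≗ρ' (a , b , φa , ψb , refl) = f a , f b , Val-homo φ ρ≗ρ' φa , Val-homo ψ ρ≗ρ' ψb , ⊛-homo a b
    Val-homo (φ ∧ ψ) ρ≗ρ' (a , b , φa , ψb , refl) = f a , f b , Val-homo φ ρ≗ρ' φa , Val-homo ψ ρ≗ρ' ψb , min-homo a b
    Val-homo (φ ⇒ ψ) ρ≗ρ' (a , b , φa , ψb , refl) = f a , f b , Val-homo φ ρ≗ρ' φa , Val-homo ψ ρ≗ρ' ψb , ⇛-homo a b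
    Val-homo ⊥f ρ≗ρ' refl = bot-homo
    Val-homo (all x φ) ρ≗ρ' inf = IsInf-homo (instances-isImage φ ρ≗ρ' x) inf
    Val-homo (ex x φ)  ρ≗ρ' sup = IsSup-homo (instances-isImage φ ρ≗ρ' x) sup

    Val-reflect (atom k i ts) ρ≗ρ' refl =
      _ , refl , cong (λ ds → f (predI k i ds)) (sym (map-cong (termVal-≗ ρ≗ρ') ts))
    Val-reflect (φ & ψ) ρ≗ρ' (_ , _ , φa , ψb , refl) with Val-reflect φ ρ≗ρ' φa | Val-reflect ψ ρ≗ρ' ψb
    ... | a , φa' , refl | b , ψb' , refl = a S.⊛ b , (a , b , φa' , ψb' , refl) , sym (⊛-homo a b)
    Val-reflect (φ ∧ ψ) ρ≗ρ' (_ , _ , φa , ψb , refl) with Val-reflect φ ρ≗ρ' φa | Val-reflect ψ ρ≗ρ' ψb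
    ... | a , φa' , refl | b , ψb' , refl = S.min a b , (a , b , φa' , ψb' , refl) , sym (min-homo a b)
    Val-reflect (φ ⇒ ψ) ρ≗ρ' (_ , _ , φa , ψb , refl) with Val-reflect φ ρ≗ρ' φa | Val-reflect ψ ρ≗ρ' ψb
    ... | a , φa' , refl | b , ψb' , refl = a S.⇛ b , (a , b , φa' , ψb' , refl) , sym (⇛-homo a b)
    Val-reflect ⊥f ρ≗ρ' refl = S.bot , refl , sym bot-homo
    Val-reflect (all x φ) ρ≗ρ' inf = IsInf-reflect (instances-isImage φ ρ≗ρ' x) inf
    Val-reflect (ex x φ)  ρ≗ρ' sup = IsSup-reflect (instances-isImage φ ρ≗ρ' x) sup

    instances-isImage φ ρ≗ρ' x = record
      { image⊆ = λ { (d , φv) → d , Val-homo φ (update-≗ ρ≗ρ' x d) φv }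
      ; ⊆image = λ { (d , φw) → let v , φv , w≡fv = Val-reflect φ (update-≗ ρ≗ρ' x d) φw in v , (d , φv) , w≡fv }
      }

  Taut-reflect : ∀ φ → T.Taut φ → S.Taut φ
  Taut-reflect φ taut M ρ v φv =
    injective (trans (taut (imageModel M) ρ (f v) (Val-homo M φ (λ _ → refl) φv)) (sym top-homo))

punchIn-< : ∀ {n} (i : Fin (suc n)) (y : Fin n) → y < i → toℕ (punchIn i y) ≡ toℕ y
punchIn-< (fsuc i) fzero    _         = refl
punchIn-< (fsuc i) (fsuc y) (s≤s y<i) = cong suc (punchIn-< i y y<i)

punchIn-≥ : ∀ {n} (i : Fin (suc n)) (y : Fin n) → i ≤ y → toℕ (punchIn i y) ≡ suc (toℕ y)
punchIn-≥ fzero    y        _         = refl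
punchIn-≥ (fsuc i) (fsuc y) (s≤s i≤y) = cong suc (punchIn-≥ i y i≤y)

opposite-punchIn : ∀ {n} (i : Fin (suc n)) (y : Fin n) →
                   opposite (punchIn i y) ≡ punchIn (opposite i) (opposite y)
opposite-punchIn {n} i y = toℕ-injective (case-split (toℕ y ℕ.<? toℕ i))
  where
  open ≡-Reasoning
  case-split : Dec (y < i) → toℕ (opposite (punchIn i y)) ≡ toℕ (punchIn (opposite i) (opposite y))
  case-split (yes y<i) = begin
    toℕ (opposite (punchIn i y))  ≡⟨ opposite-prop (punchIn i y) ⟩
    n ∸ toℕ (punchIn i y)         ≡⟨ cong (n ∸_) (punchIn-< i y y<i) ⟩
    n ∸ toℕ y                     ≡⟨ ℕ.+-∸-assoc 1 (toℕ<n y) ⟩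
    suc (n ∸ suc (toℕ y))         ≡⟨ cong suc (opposite-prop y) ⟨
    suc (toℕ (opposite y))        ≡⟨ punchIn-≥ (opposite i) (opposite y) opp-i≤opp-y ⟨
    toℕ (punchIn (opposite i) (opposite y)) ∎
    where
    opp-i≤opp-y : opposite i ≤ opposite y
    opp-i≤opp-y = subst₂ ℕ._≤_ (sym (opposite-prop i)) (sym (opposite-prop y)) (ℕ.∸-monoʳ-≤ n y<i)
  case-split (no y≮i) = begin
    toℕ (opposite (punchIn i y))  ≡⟨ opposite-prop (punchIn i y) ⟩
    n ∸ toℕ (punchIn i y)         ≡⟨ cong (n ∸_) (punchIn-≥ i y (ℕ.≮⇒≥ y≮i)) ⟩
    n ∸ suc (toℕ y)               ≡⟨ opposite-prop y ⟨
    toℕ (opposite y)              ≡⟨ punchIn-< (opposite i) (opposite y) opp-y<opp-i ⟨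
    toℕ (punchIn (opposite i) (opposite y)) ∎
    where
    opp-y<opp-i : opposite y < opposite i
    opp-y<opp-i = subst₂ ℕ._<_ (sym (opposite-prop y)) (sym (opposite-prop i))
                    (ℕ.∸-monoʳ-< (s≤s (ℕ.≮⇒≥ y≮i)) (toℕ<n y))

punchIn-≥-reflect : ∀ {n} (i : Fin (suc n)) (y : Fin n) → i ≤ punchIn i y → i ≤ y
punchIn-≥-reflect i y i≤iy with toℕ y ℕ.<? toℕ i
... | yes y<i = contradiction (subst (toℕ i ℕ.≤_) (punchIn-< i y y<i) i≤iy) (ℕ.<⇒≱ y<i)
... | no  y≮i = ℕ.≮⇒≥ y≮i

punchIn-≤-reflect : ∀ {n} (i : Fin (suc n)) (y : Fin n) → punchIn i y ≤ i → y < i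
punchIn-≤-reflect i y iy≤i with toℕ y ℕ.<? toℕ i
... | yes y<i = y<i
... | no  y≮i = contradiction (subst (ℕ._≤ toℕ i) (punchIn-≥ i y (ℕ.≮⇒≥ y≮i)) iy≤i) (ℕ.<⇒≱ (s≤s (ℕ.≮⇒≥ y≮i)))

punchIn-ceiling : ∀ {n} (i : Fin (suc n)) → toℕ i ℕ.< n → ∀ u → Ceiling (punchIn i) u
punchIn-ceiling i i<n u with i ≟ u
... | no  i≢u  = subst (Ceiling (punchIn i)) (punchIn-punchOut i≢u)
                   (image-ceiling (punchIn-cancel-≤ i _ _) (punchOut i≢u))
... | yes refl = mkCeiling c i≤ic λ y i≤iy → subst (ℕ._≤ toℕ y) (sym c≡i) (punchIn-≥-reflect i y i≤iy)
  where
  c = fromℕ< i<n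
  c≡i : toℕ c ≡ toℕ i
  c≡i = toℕ-fromℕ< i<n
  i≤ic : i ≤ punchIn i c
  i≤ic = begin
    toℕ i              ≡⟨ c≡i ⟨
    toℕ c              ≤⟨ ℕ.n≤1+n (toℕ c) ⟩
    suc (toℕ c)        ≡⟨ punchIn-≥ i c (ℕ.≤-reflexive (sym c≡i)) ⟨
    toℕ (punchIn i c)  ∎
    where open ℕ.≤-Reasoning

punchIn-floor : ∀ {n} (i : Fin n) → ∀ u → Floor (punchIn (fsuc i)) u
punchIn-floor i u with fsuc i ≟ u
... | no  i≢u  = subst (Floor (punchIn (fsuc i))) (punchIn-punchOut i≢u)
                   (image-floor (punchIn-cancel-≤ (fsuc i) _ _) (punchOut i≢u))
... | yes refl = mkFloor i ii≤i λ y iy≤i → ℕ.≤-pred (punchIn-≤-reflect (fsuc i) y iy≤i)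
  where
  ii≤i : punchIn (fsuc i) i ≤ fsuc i
  ii≤i = begin
    toℕ (punchIn (fsuc i) i)  ≡⟨ punchIn-< (fsuc i) i ℕ.≤-refl ⟩
    toℕ i                     ≤⟨ ℕ.n≤1+n (toℕ i) ⟩
    suc (toℕ i)               ∎
    where open ℕ.≤-Reasoning

infix 25 ∼_

∼_ : Formula → Formula
∼ φ = φ ⇒ ⊥f

module Values (m : ℕ) (M : NMChain.Model m) where
  open NMChain m

  record ValueIs (φ : Formula) (a : C) : Set where
    constructor valueIs
    field unique : ∀ {e v} → Val M φ e v → v ≡ a

  record HasValue (φ : Formula) (a : C) : Set where
    constructor hasValue
    field value : ∀ e → Val M φ e a

  open ValueIs
  open HasValue

  ValueIs-& : ∀ {φ ψ a b} → ValueIs φ a → ValueIs ψ b → ValueIs (φ & ψ) (a ⊛ b)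
  ValueIs-& φ≡a ψ≡b = valueIs λ (_ , _ , φa , ψb , v≡) → trans v≡ (cong₂ _⊛_ (unique φ≡a φa) (unique ψ≡b ψb))

  ValueIs-⇒ : ∀ {φ ψ a b} → ValueIs φ a → ValueIs ψ b → ValueIs (φ ⇒ ψ) (a ⇛ b)
  ValueIs-⇒ φ≡a ψ≡b = valueIs λ (_ , _ , φa , ψb , v≡) → trans v≡ (cong₂ _⇛_ (unique φ≡a φa) (unique ψ≡b ψb))

  ValueIs-∼ : ∀ {φ a} → ValueIs φ a → ValueIs (∼ φ) (a ⇛ bot)
  ValueIs-∼ φ≡a = ValueIs-⇒ φ≡a (valueIs λ v≡bot → v≡bot)

  HasValue-& : ∀ {φ ψ a b} → HasValue φ a → HasValue ψ b → HasValue (φ & ψ) (a ⊛ b)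
  HasValue-& {a = a} {b} φa ψb = hasValue λ e → a , b , value φa e , value ψb e , refl

  HasValue-⇒ : ∀ {φ ψ a b} → HasValue φ a → HasValue ψ b → HasValue (φ ⇒ ψ) (a ⇛ b)
  HasValue-⇒ {a = a} {b} φa ψb = hasValue λ e → a , b , value φa e , value ψb e , refl

  HasValue-∼ : ∀ {φ a} → HasValue φ a → HasValue (∼ φ) (a ⇛ bot)
  HasValue-∼ φa = HasValue-⇒ φa (hasValue λ _ → refl)

p : Formula
p = atom 0 0 []

χ : Formula
χ = ∼ (p & p) ⇒ (∼ p & ∼ p)

noFixpoint : Formula
noFixpoint = ∼ χ ⇒ χ

module NoFixpoint (m : ℕ) where
  open NMChain m
  open NMChainProperties m

  χ⟦_⟧ : C → C
  χ⟦ x ⟧ = ((x ⊛ x) ⇛ bot) ⇛ ((x ⇛ bot) ⊛ (x ⇛ bot))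

  noFixpoint⟦_⟧ : C → C
  noFixpoint⟦ x ⟧ = (χ⟦ x ⟧ ⇛ bot) ⇛ χ⟦ x ⟧

  χ⟦⟧-upper : ∀ {x} → neg x < x → χ⟦ x ⟧ ≡ x
  χ⟦⟧-upper {x} nx<x = begin
    ((x ⊛ x) ⇛ bot) ⇛ ((x ⇛ bot) ⊛ (x ⇛ bot))
      ≡⟨ cong₂ _⇛_ (cong (_⇛ bot) (⊛-self-neg< nx<x)) (cong₂ _⊛_ (⇛-bot x) (⇛-bot x)) ⟩
    (x ⇛ bot) ⇛ (neg x ⊛ neg x)
      ≡⟨ cong₂ _⇛_ (⇛-bot x) (⊛-≤neg nx≤nnx) ⟩
    neg x ⇛ bot
      ≡⟨ ⇛-bot (neg x) ⟩
    neg (neg x)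
      ≡⟨ opposite-involutive x ⟩
    x ∎
    where
    open ≡-Reasoning
    nx≤nnx : neg x ≤ neg (neg x)
    nx≤nnx = subst (neg x ≤_) (sym (opposite-involutive x)) (ℕ.<⇒≤ nx<x)

  χ⟦⟧-lower : ∀ {x} → x < neg x → χ⟦ x ⟧ ≡ neg x
  χ⟦⟧-lower {x} x<nx = begin
    ((x ⊛ x) ⇛ bot) ⇛ ((x ⇛ bot) ⊛ (x ⇛ bot))
      ≡⟨ cong₂ _⇛_ (cong (_⇛ bot) (⊛-≤neg (ℕ.<⇒≤ x<nx))) (cong₂ _⊛_ (⇛-bot x) (⇛-bot x)) ⟩
    (bot ⇛ bot) ⇛ (neg x ⊛ neg x)
      ≡⟨ cong₂ _⇛_ (⇛-bot bot) (⊛-self-neg< nnx<nx) ⟩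
    top ⇛ neg x
      ≡⟨ top-⇛ (neg x) ⟩
    neg x ∎
    where
    open ≡-Reasoning
    nnx<nx : neg (neg x) < neg x
    nnx<nx = subst (_< neg x) (sym (opposite-involutive x)) x<nx

  χ⟦⟧-fixpoint : ∀ {x} → neg x ≡ x → χ⟦ x ⟧ ≡ bot
  χ⟦⟧-fixpoint {x} nx≡x = begin
    ((x ⊛ x) ⇛ bot) ⇛ ((x ⇛ bot) ⊛ (x ⇛ bot))
      ≡⟨ cong₂ _⇛_ (cong (_⇛ bot) x⊛x≡bot) (cong₂ _⊛_ x⇛bot≡x x⇛bot≡x) ⟩
    (bot ⇛ bot) ⇛ (x ⊛ x)
      ≡⟨ cong₂ _⇛_ (⇛-bot bot) x⊛x≡bot ⟩
    top ⇛ bot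
      ≡⟨ top-⇛ bot ⟩
    bot ∎
    where
    open ≡-Reasoning
    x⊛x≡bot : x ⊛ x ≡ bot
    x⊛x≡bot = ⊛-≤neg (≤-reflexive (sym nx≡x))
    x⇛bot≡x : x ⇛ bot ≡ x
    x⇛bot≡x = trans (⇛-bot x) nx≡x

  ∼-⇛-self : ∀ {y} → neg y ≤ y → (y ⇛ bot) ⇛ y ≡ top
  ∼-⇛-self {y} ny≤y = trans (cong (_⇛ y) (⇛-bot y)) (⇛-≤ ny≤y)

  noFixpoint⟦⟧-top : ∀ {x} → neg x < x ⊎ x < neg x → noFixpoint⟦ x ⟧ ≡ top
  noFixpoint⟦⟧-top {x} (inj₁ nx<x) =
    subst (λ c → (c ⇛ bot) ⇛ c ≡ top) (sym (χ⟦⟧-upper nx<x)) (∼-⇛-self (ℕ.<⇒≤ nx<x))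
  noFixpoint⟦⟧-top {x} (inj₂ x<nx) =
    subst (λ c → (c ⇛ bot) ⇛ c ≡ top) (sym (χ⟦⟧-lower x<nx))
      (∼-⇛-self (subst (_≤ neg x) (sym (opposite-involutive x)) (ℕ.<⇒≤ x<nx)))

  noFixpoint⟦⟧-fixpoint : ∀ {x} → neg x ≡ x → noFixpoint⟦ x ⟧ ≡ bot
  noFixpoint⟦⟧-fixpoint {x} nx≡x =
    subst (λ c → (c ⇛ bot) ⇛ c ≡ bot) (sym (χ⟦⟧-fixpoint nx≡x))
      (trans (cong (_⇛ bot) (⇛-bot bot)) (top-⇛ bot))

  module _ (M : Model) where
    open Model M
    open Values m M

    ValueIs-noFixpoint : ValueIs noFixpoint noFixpoint⟦ predI 0 0 [] ⟧
    ValueIs-noFixpoint = ValueIs-⇒ (ValueIs-∼ ValueIs-χ) ValueIs-χ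
      where
      ValueIs-p : ValueIs p (predI 0 0 [])
      ValueIs-p = valueIs sym
      ValueIs-χ : ValueIs χ χ⟦ predI 0 0 [] ⟧
      ValueIs-χ = ValueIs-⇒ (ValueIs-∼ (ValueIs-& ValueIs-p ValueIs-p))
                            (ValueIs-& (ValueIs-∼ ValueIs-p) (ValueIs-∼ ValueIs-p))

    HasValue-noFixpoint : HasValue noFixpoint noFixpoint⟦ predI 0 0 [] ⟧
    HasValue-noFixpoint = HasValue-⇒ (HasValue-∼ HasValue-χ) HasValue-χ
      where
      HasValue-p : HasValue p (predI 0 0 [])
      HasValue-p = hasValue λ _ → refl
      HasValue-χ : HasValue χ χ⟦ predI 0 0 [] ⟧
      HasValue-χ = HasValue-⇒ (HasValue-∼ (HasValue-& HasValue-p HasValue-p))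
                              (HasValue-& (HasValue-∼ HasValue-p) (HasValue-∼ HasValue-p))

  constModel : C → Model
  constModel x = record { Dom = ⊤ ; witness = tt ; predI = λ _ _ _ → x ; constI = λ _ → tt }

  Taut-noFixpoint : (∀ x → noFixpoint⟦ x ⟧ ≡ top) → Taut noFixpoint
  Taut-noFixpoint allTop M e v val =
    trans (Values.ValueIs.unique (ValueIs-noFixpoint M) {e} val) (allTop (Model.predI M 0 0 []))

  Taut-noFixpoint⁻¹ : Taut noFixpoint → ∀ x → noFixpoint⟦ x ⟧ ≡ top
  Taut-noFixpoint⁻¹ taut x =
    taut (constModel x) (λ _ → tt) _ (Values.HasValue.value (HasValue-noFixpoint (constModel x)) _)

module _ (j : ℕ) where
  private
    m : ℕ
    m = j + suc j
    module Even = NoFixpoint m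
    module Odd  = NoFixpoint (suc m)
    open NMChain m using (neg)

  half : Fin (suc m)
  half = fromℕ< (s≤s (ℕ.m≤m+n j (suc j)))

  middle : Fin (suc (suc m))
  middle = fsuc half

  toℕ-middle : toℕ middle ≡ suc j
  toℕ-middle = cong suc (toℕ-fromℕ< (s≤s (ℕ.m≤m+n j (suc j))))

  opposite-middle : opposite middle ≡ middle
  opposite-middle = toℕ-injective (begin
    toℕ (opposite middle)   ≡⟨ opposite-prop middle ⟩
    suc m ∸ toℕ middle      ≡⟨ cong (suc m ∸_) toℕ-middle ⟩
    m ∸ j                   ≡⟨ ℕ.m+n∸m≡n j (suc j) ⟩
    suc j                   ≡⟨ toℕ-middle ⟨
    toℕ middle              ∎)
    where open ≡-Reasoning

  middle<last : toℕ middle ℕ.< suc m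
  middle<last = subst (ℕ._< suc m) (sym toℕ-middle) (s≤s (ℕ.m<m+n j (s≤s z≤n)))

  punchIn-middle-isCompleteEmbedding : IsCompleteEmbedding (punchIn middle)
  punchIn-middle-isCompleteEmbedding = record
    { mono-≤   = punchIn-mono-≤ middle _ _
    ; cancel-≤ = punchIn-cancel-≤ middle _ _
    ; neg-homo = λ x → sym (trans (opposite-punchIn middle x) (cong (λ i → punchIn i (opposite x)) opposite-middle))
    ; bot-homo = refl
    ; ceiling  = punchIn-ceiling middle middle<last
    ; floor    = punchIn-floor half
    }

  neg-lower : ∀ (x : Fin (suc m)) → toℕ x ℕ.≤ j → x < neg x
  neg-lower x x≤j = begin-strict
    toℕ x          <⟨ s≤s x≤j ⟩
    suc j          ≡⟨ ℕ.m+n∸m≡n j (suc j) ⟨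
    m ∸ j          ≤⟨ ℕ.∸-monoʳ-≤ m x≤j ⟩
    m ∸ toℕ x      ≡⟨ opposite-prop x ⟨
    toℕ (neg x)    ∎
    where open ℕ.≤-Reasoning

  neg-upper : ∀ (x : Fin (suc m)) → j ℕ.< toℕ x → neg x < x
  neg-upper x j<x = begin-strict
    toℕ (neg x)    ≡⟨ opposite-prop x ⟩
    m ∸ toℕ x      ≤⟨ ℕ.∸-monoʳ-≤ m j<x ⟩
    m ∸ suc j      ≡⟨ ℕ.m+n∸n≡m j (suc j) ⟩
    j              <⟨ j<x ⟩
    toℕ x          ∎
    where open ℕ.≤-Reasoning

  neg-apart : ∀ (x : Fin (suc m)) → neg x < x ⊎ x < neg x
  neg-apart x with toℕ x ℕ.≤? j
  ... | yes x≤j = inj₂ (neg-lower x x≤j)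
  ... | no  x≰j = inj₁ (neg-upper x (ℕ.≰⇒> x≰j))

  noFixpoint-taut : NMChain.Taut m noFixpoint
  noFixpoint-taut = Even.Taut-noFixpoint (λ x → Even.noFixpoint⟦⟧-top (neg-apart x))

  noFixpoint-notTaut : ¬ NMChain.Taut (suc m) noFixpoint
  noFixpoint-notTaut taut =
    bot≢top (trans (sym (Odd.noFixpoint⟦⟧-fixpoint opposite-middle)) (Odd.Taut-noFixpoint⁻¹ taut middle))
    where
    bot≢top : NMChain.bot (suc m) ≢ NMChain.top (suc m)
    bot≢top ()

  TAUT-odd⊊even : TAUT (suc (suc m)) ⊊ TAUT (suc m)
  TAUT-odd⊊even = CompleteEmbedding.Taut-reflect punchIn-middle-isCompleteEmbedding
                , noFixpoint , noFixpoint-taut , noFixpoint-notTaut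

even>1-form : ∀ {n} → 2 ∣ n → 1 ℕ.< n → Σ ℕ λ j → n ≡ suc (j + suc j)
even>1-form (divides zero refl) ()
even>1-form (divides (suc j) refl) _ = j , cong suc (begin
  suc (j * 2)        ≡⟨ cong suc (ℕ.*-comm j 2) ⟩
  suc (j + (j + 0))  ≡⟨ cong (λ k → suc (j + k)) (ℕ.+-identityʳ j) ⟩
  suc (j + j)        ≡⟨ ℕ.+-suc j j ⟨
  j + suc j          ∎)
  where open ≡-Reasoning

mainTheorem14 : (n : ℕ) → 2 ∣ n → 1 ℕ.< n → TAUT (n + 1) ⊊ TAUT n
mainTheorem14 n 2∣n 1<n with even>1-form 2∣n 1<n
... | j , refl = subst (λ k → TAUT k ⊊ TAUT n′) (ℕ.+-comm 1 n′) (TAUT-odd⊊even j)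
  where n′ = suc (j + suc j)
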